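{- Let $A_1,A_2,B_1,B_2,Y_1,Y_2\in\mathbb{Q}[x,x^{ -1}][[t]]$ be such that $\operatorname{ord}_t B_1>0$, $\operatorname{ord}_t B_2>0$, $\operatorname{ord}_t Y_1>0$ and $\operatorname{ord}_t Y_2>0$. Then there exists at most one pair $(U_1,U_2)\in\mathbb{Q}[[x,t]]^2$ with $$U_1(t,x)=A_1(t,x)+B_1(t,x)\cdot U_2(t,Y_1(t,x)),\qquad U_2(t,x)=A_2(t,x)+B_2(t,x)\cdot U_1(t,Y_2(t,x)).$$
   Context: $\operatorname{ord}_t S$ denotes the valuation (order) of a power series $S$ with respect to $t$. For $U\in\mathbb{Q}[[x,t]]$ and $Y\in\mathbb{Q}[x,x^{ -1}][[t]]$ with $\operatorname{ord}_t Y>0$, $U(t,Y(t,x))$ denotes the series obtained by substituting $Y(t,x)$ for $x$ in $U(t,x)$, which is well defined in $\mathbb{Q}[x,x^{ -1}][[t]]$. -}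

module Defs where

open import Data.Nat using (ℕ; zero; suc; _⊔_; _∸_) renaming (_+_ to _+ℕ_)
open import Data.Integer using (ℤ; +_; -[1+_])
open import Data.Rational using (ℚ; 0ℚ; 1ℚ; _+_; _*_)
open import Data.List using (List; []; _∷_; map; replicate; _++_)
open import Data.Product using (_×_)
open import Relation.Binary.PropositionalEquality using (_≡_)

-- Laurent polynomials in x over ℚ  (elements of ℚ[x,x⁻¹])
-- mkLP k cs  represents  Σ_i cs[i] · x^(i - k).

record LP : Set where
  constructor mkLP
  field
    low : ℕ
    cs  : List ℚ

nth : List ℚ → ℕ → ℚ
nth []       _       = 0ℚ
nth (c ∷ cs) zero    = c
nth (c ∷ cs) (suc i) = nth cs i

coeffLP : LP → ℤ → ℚ
coeffLP (mkLP k cs) (+ n)      = nth cs (n +ℕ k)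
coeffLP (mkLP k cs) -[1+ n ]   = go k (suc n)
  where
  -- index (k - (n+1)) if nonnegative, else 0
  go : ℕ → ℕ → ℚ
  go k'       zero     = nth cs k'
  go zero     (suc _)  = 0ℚ
  go (suc k') (suc n') = go k' n'

addList : List ℚ → List ℚ → List ℚ
addList []       bs       = bs
addList as       []       = as
addList (a ∷ as) (b ∷ bs) = (a + b) ∷ addList as bs

mulList : List ℚ → List ℚ → List ℚ
mulList []       bs = []
mulList (a ∷ as) bs = addList (map (a *_) bs) (0ℚ ∷ mulList as bs)

zeroLP : LP
zeroLP = mkLP 0 []

oneLP : LP
oneLP = mkLP 0 (1ℚ ∷ [])

addLP : LP → LP → LP
addLP (mkLP k cs) (mkLP l ds) =
  mkLP (k ⊔ l) (addList (replicate ((k ⊔ l) ∸ k) 0ℚ ++ cs)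
                        (replicate ((k ⊔ l) ∸ l) 0ℚ ++ ds))

mulLP : LP → LP → LP
mulLP (mkLP k cs) (mkLP l ds) = mkLP (k +ℕ l) (mulList cs ds)

scaleLP : ℚ → LP → LP
scaleLP q (mkLP k cs) = mkLP k (map (q *_) cs)

-- ℚ[x,x⁻¹][[t]] : a series is its sequence of t-coefficients.

LSeries : Set
LSeries = ℕ → LP

sumTo : ℕ → (ℕ → LP) → LP
sumTo zero    f = f 0
sumTo (suc n) f = addLP (sumTo n f) (f (suc n))

addLS : LSeries → LSeries → LSeries
addLS A B n = addLP (A n) (B n)

mulLS : LSeries → LSeries → LSeries
mulLS A B n = sumTo n (λ i → mulLP (A i) (B (n ∸ i)))

oneLS : LSeries
oneLS zero    = oneLP
oneLS (suc _) = zeroLP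

powLS : LSeries → ℕ → LSeries
powLS Y zero    = oneLS
powLS Y (suc j) = mulLS Y (powLS Y j)

ordPos : LSeries → Set
ordPos S = ∀ (m : ℤ) → coeffLP (S 0) m ≡ 0ℚ

-- ℚ[[x,t]] : U k j is the coefficient of t^k x^j.

PS2 : Set
PS2 = ℕ → ℕ → ℚ

-- U(t, Y(t,x)) = Σ_{k,j} U k j · t^k · Y^j.  When ord_t Y > 0, Y^j has
-- t-order ≥ j, so the t^n coefficient only involves k ≤ n and j ≤ n:
-- [t^n] U(t,Y) = Σ_{k≤n} Σ_{j≤n} U k j · [t^(n-k)] Y^j .
substPS : PS2 → LSeries → LSeries
substPS U Y n =
  sumTo n (λ k → sumTo n (λ j → scaleLP (U k j) (powLS Y j (n ∸ k))))

coeffPS : PS2 → ℕ → ℤ → ℚ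
coeffPS U n (+ j)      = U n j
coeffPS U n -[1+ _ ]   = 0ℚ

_≐_ : PS2 → LSeries → Set
U ≐ S = ∀ (n : ℕ) (m : ℤ) → coeffPS U n m ≡ coeffLP (S n) m

IsSolution : (A₁ A₂ B₁ B₂ Y₁ Y₂ : LSeries) → PS2 → PS2 → Set
IsSolution A₁ A₂ B₁ B₂ Y₁ Y₂ U₁ U₂ =
  (U₁ ≐ addLS A₁ (mulLS B₁ (substPS U₂ Y₁))) ×
  (U₂ ≐ addLS A₂ (mulLS B₂ (substPS U₁ Y₂)))

module Submission where

-- Idea: the equations determine the solution row by row in t.  The t^n
-- coefficient of the substitution U(t,Y) only involves the rows U k _ with
-- k ≤ n, and since ord_t B > 0 the t^n coefficient of B · S only involves
-- the coefficients S p with p < n.  Hence row n of U₁ (resp. U₂) is a function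
-- of A₁, B₁ (resp. A₂, B₂) and of the rows k < n of U₂ (resp. U₁), and two
-- solutions agree on every row by strong induction on n.

open import Defs
open import Data.Nat using (ℕ; zero; suc; _≤_; _<_; z≤n; s≤s; _⊔_; _∸_; _≤?_)
  renaming (_+_ to _+ℕ_)
open import Data.Nat.Properties
  using (m∸n≤m; m∸n+n≡m; ≰⇒>; m≤m⊔n; m≤n⊔m; ≤-refl; ≤-trans; n≤1+n; +-suc; <-≤-trans)
open import Data.Nat.Induction using (<-rec)
open import Data.Integer using (+_; -[1+_])
open import Data.Rational using (ℚ; 0ℚ; _+_; _*_)
open import Data.Rational.Properties using (+-identityˡ; +-identityʳ; *-zeroˡ; *-zeroʳ)
open import Data.List using (List; []; _∷_; map; replicate; _++_)
open import Data.Product using (_×_; _,_; proj₁; proj₂)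
open import Relation.Nullary using (yes; no)
open import Relation.Binary.PropositionalEquality
  using (_≡_; refl; sym; trans; cong; cong₂; module ≡-Reasoning)

IsZeroLP : LP → Set
IsZeroLP P = ∀ m → coeffLP P m ≡ 0ℚ

nth-addList : ∀ as bs i → nth (addList as bs) i ≡ nth as i + nth bs i
nth-addList []       bs       i       = sym (+-identityˡ (nth bs i))
nth-addList (a ∷ as) []       i       = sym (+-identityʳ (nth (a ∷ as) i))
nth-addList (a ∷ as) (b ∷ bs) zero    = refl
nth-addList (a ∷ as) (b ∷ bs) (suc i) = nth-addList as bs i

coeff-addList : ∀ k as bs m →
  coeffLP (mkLP k (addList as bs)) m ≡ coeffLP (mkLP k as) m + coeffLP (mkLP k bs) m
coeff-addList k       as bs (+ n)          = nth-addList as bs (n +ℕ k)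
coeff-addList zero    as bs -[1+ n ]       = sym (+-identityˡ 0ℚ)
coeff-addList (suc k) as bs -[1+ zero ]    = nth-addList as bs k
coeff-addList (suc k) as bs -[1+ suc n ]   = coeff-addList k as bs -[1+ n ]

coeff-shift : ∀ k cs m → coeffLP (mkLP (suc k) (0ℚ ∷ cs)) m ≡ coeffLP (mkLP k cs) m
coeff-shift k       cs (+ n) rewrite +-suc n k = refl
coeff-shift zero    cs -[1+ zero ]  = refl
coeff-shift (suc k) cs -[1+ zero ]  = refl
coeff-shift zero    cs -[1+ suc n ] = refl
coeff-shift (suc k) cs -[1+ suc n ] = coeff-shift k cs -[1+ n ]

coeff-pad : ∀ K k cs m → k ≤ K →
  coeffLP (mkLP K (replicate (K ∸ k) 0ℚ ++ cs)) m ≡ coeffLP (mkLP k cs) m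
coeff-pad K k cs m k≤K =
  trans (cong (λ K′ → coeffLP (mkLP K′ (replicate (K ∸ k) 0ℚ ++ cs)) m) (sym (m∸n+n≡m k≤K)))
        (pad (K ∸ k))
  where
  pad : ∀ d → coeffLP (mkLP (d +ℕ k) (replicate d 0ℚ ++ cs)) m ≡ coeffLP (mkLP k cs) m
  pad zero    = refl
  pad (suc d) = trans (coeff-shift (d +ℕ k) (replicate d 0ℚ ++ cs) m) (pad d)

coeff-addLP : ∀ P Q m → coeffLP (addLP P Q) m ≡ coeffLP P m + coeffLP Q m
coeff-addLP (mkLP k cs) (mkLP l ds) m =
  trans (coeff-addList (k ⊔ l) _ _ m)
        (cong₂ _+_ (coeff-pad (k ⊔ l) k cs m (m≤m⊔n k l))
                   (coeff-pad (k ⊔ l) l ds m (m≤n⊔m k l)))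

AllZero : List ℚ → Set
AllZero cs = ∀ i → nth cs i ≡ 0ℚ

coeff-negative : ∀ j i cs → coeffLP (mkLP (j +ℕ suc i) cs) -[1+ j ] ≡ nth cs i
coeff-negative zero    i cs = refl
coeff-negative (suc j) i cs = coeff-negative j i cs

-- Every list entry is some coefficient, so a zero polynomial has a zero list.
isZero⇒allZero : ∀ k cs → IsZeroLP (mkLP k cs) → AllZero cs
isZero⇒allZero k cs zeroP i with k ≤? i
... | yes k≤i = trans (cong (nth cs) (sym (m∸n+n≡m k≤i))) (zeroP (+ (i ∸ k)))
... | no  k≰i = trans (sym entry) (zeroP -[1+ k ∸ suc i ])
  where
  entry : coeffLP (mkLP k cs) -[1+ k ∸ suc i ] ≡ nth cs i
  entry = trans (cong (λ K → coeffLP (mkLP K cs) -[1+ k ∸ suc i ]) (sym (m∸n+n≡m (≰⇒> k≰i))))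
                (coeff-negative (k ∸ suc i) i cs)

allZero⇒isZero : ∀ k cs → AllZero cs → IsZeroLP (mkLP k cs)
allZero⇒isZero k       cs zs (+ n)         = zs (n +ℕ k)
allZero⇒isZero zero    cs zs -[1+ n ]      = refl
allZero⇒isZero (suc k) cs zs -[1+ zero ]   = zs k
allZero⇒isZero (suc k) cs zs -[1+ suc n ]  = allZero⇒isZero k cs zs -[1+ n ]

nth-scale : ∀ q bs i → nth (map (q *_) bs) i ≡ q * nth bs i
nth-scale q []       i       = sym (*-zeroʳ q)
nth-scale q (b ∷ bs) zero    = refl
nth-scale q (b ∷ bs) (suc i) = nth-scale q bs i

mulList-allZeroˡ : ∀ as bs → AllZero as → AllZero (mulList as bs)
mulList-allZeroˡ []       bs zs i = refl
mulList-allZeroˡ (a ∷ as) bs zs i = begin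
  nth (addList (map (a *_) bs) (0ℚ ∷ mulList as bs)) i
    ≡⟨ nth-addList (map (a *_) bs) (0ℚ ∷ mulList as bs) i ⟩
  nth (map (a *_) bs) i + nth (0ℚ ∷ mulList as bs) i
    ≡⟨ cong₂ _+_ scaled (shifted i) ⟩
  0ℚ + 0ℚ
    ≡⟨ +-identityˡ 0ℚ ⟩
  0ℚ ∎
  where
  open ≡-Reasoning
  scaled : nth (map (a *_) bs) i ≡ 0ℚ
  scaled = trans (nth-scale a bs i) (trans (cong (_* nth bs i) (zs 0)) (*-zeroˡ (nth bs i)))
  shifted : ∀ i → nth (0ℚ ∷ mulList as bs) i ≡ 0ℚ
  shifted zero    = refl
  shifted (suc i) = mulList-allZeroˡ as bs (λ j → zs (suc j)) i

mulLP-zeroˡ : ∀ P X → IsZeroLP P → IsZeroLP (mulLP P X)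
mulLP-zeroˡ (mkLP k cs) (mkLP l ds) zeroP =
  allZero⇒isZero (k +ℕ l) (mulList cs ds) (mulList-allZeroˡ cs ds (isZero⇒allZero k cs zeroP))

sumTo-cong : ∀ n (f g : ℕ → LP) → (∀ i → i ≤ n → f i ≡ g i) → sumTo n f ≡ sumTo n g
sumTo-cong zero    f g f≡g = f≡g 0 z≤n
sumTo-cong (suc n) f g f≡g =
  cong₂ addLP (sumTo-cong n f g (λ i i≤n → f≡g i (≤-trans i≤n (n≤1+n n)))) (f≡g (suc n) ≤-refl)

coeff-sumTo-cong : ∀ n (f g : ℕ → LP) m →
  (∀ i → i ≤ n → coeffLP (f i) m ≡ coeffLP (g i) m) →
  coeffLP (sumTo n f) m ≡ coeffLP (sumTo n g) m
coeff-sumTo-cong zero    f g m f≡g = f≡g 0 z≤n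
coeff-sumTo-cong (suc n) f g m f≡g = begin
  coeffLP (addLP (sumTo n f) (f (suc n))) m
    ≡⟨ coeff-addLP (sumTo n f) (f (suc n)) m ⟩
  coeffLP (sumTo n f) m + coeffLP (f (suc n)) m
    ≡⟨ cong₂ _+_ (coeff-sumTo-cong n f g m (λ i i≤n → f≡g i (≤-trans i≤n (n≤1+n n))))
                 (f≡g (suc n) ≤-refl) ⟩
  coeffLP (sumTo n g) m + coeffLP (g (suc n)) m
    ≡⟨ sym (coeff-addLP (sumTo n g) (g (suc n)) m) ⟩
  coeffLP (addLP (sumTo n g) (g (suc n))) m ∎
  where open ≡-Reasoning

substPS-causal : ∀ (U V : PS2) Y p → (∀ k → k ≤ p → ∀ j → U k j ≡ V k j) →
  substPS U Y p ≡ substPS V Y p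
substPS-causal U V Y p U≡V = sumTo-cong p _ _ (λ k k≤p →
  sumTo-cong p _ _ (λ j _ → cong (λ q → scaleLP q (powLS Y j (p ∸ k))) (U≡V k k≤p j)))

mulLS-causal : ∀ B → ordPos B → ∀ (S T : LSeries) n → (∀ p → p < n → S p ≡ T p) →
  ∀ m → coeffLP (mulLS B S n) m ≡ coeffLP (mulLS B T n) m
mulLS-causal B ordB S T n S≡T m = coeff-sumTo-cong n _ _ m term
  where
  term : ∀ i → i ≤ n → coeffLP (mulLP (B i) (S (n ∸ i))) m ≡ coeffLP (mulLP (B i) (T (n ∸ i))) m
  term zero    _ = trans (mulLP-zeroˡ (B 0) (S n) ordB m) (sym (mulLP-zeroˡ (B 0) (T n) ordB m))
  term (suc i) (s≤s {n = n′} i≤n′) =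
    cong (λ X → coeffLP (mulLP (B (suc i)) X) m) (S≡T (n′ ∸ i) (s≤s (m∸n≤m n′ i)))

row-determined : ∀ (A B Y : LSeries) → ordPos B → (U V P Q : PS2) →
  U ≐ addLS A (mulLS B (substPS P Y)) → V ≐ addLS A (mulLS B (substPS Q Y)) →
  ∀ n → (∀ k → k < n → ∀ j → P k j ≡ Q k j) → ∀ j → U n j ≡ V n j
row-determined A B Y ordB U V P Q eqU eqV n P≡Q j = begin
  U n j
    ≡⟨ eqU n (+ j) ⟩
  coeffLP (addLP (A n) (mulLS B (substPS P Y) n)) (+ j)
    ≡⟨ coeff-addLP (A n) _ (+ j) ⟩
  coeffLP (A n) (+ j) + coeffLP (mulLS B (substPS P Y) n) (+ j)
    ≡⟨ cong (λ z → coeffLP (A n) (+ j) + z) (mulLS-causal B ordB _ _ n substEq (+ j)) ⟩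
  coeffLP (A n) (+ j) + coeffLP (mulLS B (substPS Q Y) n) (+ j)
    ≡⟨ sym (coeff-addLP (A n) _ (+ j)) ⟩
  coeffLP (addLP (A n) (mulLS B (substPS Q Y) n)) (+ j)
    ≡⟨ sym (eqV n (+ j)) ⟩
  V n j ∎
  where
  open ≡-Reasoning
  substEq : ∀ p → p < n → substPS P Y p ≡ substPS Q Y p
  substEq p p<n = substPS-causal P Q Y p (λ k k≤p → P≡Q k (<-≤-trans (s≤s k≤p) p<n))

lemma7 : (A₁ A₂ B₁ B₂ Y₁ Y₂ : LSeries) →
         ordPos B₁ → ordPos B₂ → ordPos Y₁ → ordPos Y₂ →
         (U₁ U₂ V₁ V₂ : PS2) →
         IsSolution A₁ A₂ B₁ B₂ Y₁ Y₂ U₁ U₂ →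
         IsSolution A₁ A₂ B₁ B₂ Y₁ Y₂ V₁ V₂ →
         (∀ (k j : ℕ) → U₁ k j ≡ V₁ k j) × (∀ (k j : ℕ) → U₂ k j ≡ V₂ k j)
lemma7 A₁ A₂ B₁ B₂ Y₁ Y₂ ordB₁ ordB₂ _ _ U₁ U₂ V₁ V₂ (eqU₁ , eqU₂) (eqV₁ , eqV₂) =
  (λ k → proj₁ (rowsAgree k)) , (λ k → proj₂ (rowsAgree k))
  where
  RowsAgree : ℕ → Set
  RowsAgree k = (∀ j → U₁ k j ≡ V₁ k j) × (∀ j → U₂ k j ≡ V₂ k j)

  step : ∀ n → (∀ {k} → k < n → RowsAgree k) → RowsAgree n
  step n below =
    row-determined A₁ B₁ Y₁ ordB₁ U₁ V₁ U₂ V₂ eqU₁ eqV₁ n (λ k k<n → proj₂ (below k<n)) ,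
    row-determined A₂ B₂ Y₂ ordB₂ U₂ V₂ U₁ V₁ eqU₂ eqV₂ n (λ k k<n → proj₁ (below k<n))

  rowsAgree : ∀ k → RowsAgree k
  rowsAgree = <-rec RowsAgree step
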